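{- Let $\mathscr{C}=\{f_i:i\in\mathbb{N}\}$ be a computably enumerable class of total computable functions which is dense in the Baire space $\mathbb{N}^\mathbb{N}$, and let $h$ be a computable order. Then $A_{\mathscr{C},h}$ has empty interior in $\mathscr{C}$ (there is no $u\in\mathbb{N}^*$ with $\emptyset\neq[u]\cap\mathscr{C}\subseteq A_{\mathscr{C},h}$). Consequently, $A_{\mathscr{C},h}\cap\mathscr{C}$ is not semi-decidable when the input function is given as an oracle: there is no oracle Turing machine $M$ such that for every $f\in\mathscr{C}$, $M^f$ halts if and only if $f\in A_{\mathscr{C},h}$.
   Context: $\mathscr{C}$ is computably enumerable means there is a numbering $\mathscr{C}=\{f_i:i\in\mathbb{N}\}$ such that $(i,n)\mapsto f_i(n)$ is computable. For $f\in\mathbb{N}^\mathbb{N}$, $f\restriction n=(f(0),\dots,f(n-1))$; $f$ extends $v\in\mathbb{N}^*$ of length $n$ if $f\restriction n=v$; the cylinder $[v]$ is the set of all extensions of $v$, and cylinders form a basis of the topology of the Baire space. For a finite sequence $v$, $K_\mathscr{C}(v)=\min\{i:f_i\text{ extends }v\}$. A computable order is a computable, non-decreasing, unbounded function $h:\mathbb{N}\to\mathbb{N}$. $A_{\mathscr{C},h}=\{f:\mathbb{N}\to\mathbb{N}:\forall n,\ K_\mathscr{C}(f\restriction n)\le h(n)\}$. -}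

module Defs where

open import Data.Nat using (ℕ; _≤_)
open import Data.List using (List; map; upTo; length)
open import Data.Bool using (Bool; true)
open import Data.Product using (Σ; ∃; _×_)
open import Relation.Binary.PropositionalEquality using (_≡_)
open import Relation.Nullary using (¬_)

-- Baire space points: total functions ℕ → ℕ (every Agda function is computable)
Baire : Set
Baire = ℕ → ℕ

_↾_ : Baire → ℕ → List ℕ
f ↾ n = map f (upTo n)

Extends : Baire → List ℕ → Set
Extends f v = f ↾ length v ≡ v

-- A computably enumerable class 𝒞 = {f_i} is given by its numbering
-- C : ℕ → Baire, i.e. the computable map (i , n) ↦ f_i(n).
Numbering : Set
Numbering = ℕ → Baire

Dense : Numbering → Set
Dense C = (v : List ℕ) → ∃ λ i → Extends (C i) v

IsOrder : (ℕ → ℕ) → Set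
IsOrder h = (∀ {m n} → m ≤ n → h m ≤ h n) × (∀ m → ∃ λ n → m ≤ h n)

-- K_𝒞(v) ≤ k, unfolded: the least index i with f_i extending v is ≤ k,
-- i.e. some index i ≤ k has f_i extending v.
K≤ : Numbering → List ℕ → ℕ → Set
K≤ C v k = ∃ λ i → i ≤ k × Extends (C i) v

InA : Numbering → (ℕ → ℕ) → Baire → Set
InA C h f = ∀ n → K≤ C (f ↾ n) (h n)

NonemptyInteriorIn𝒞 : Numbering → (ℕ → ℕ) → Set
NonemptyInteriorIn𝒞 C h =
  Σ (List ℕ) λ u → (∃ λ i → Extends (C i) u)
                 × (∀ i → Extends (C i) u → InA C h (C i))

-- Oracle machines: an oracle Turing machine M is modelled by the (computable)
-- predicate M v = true iff M, run for |v| steps with oracle answers v,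
-- halts having queried only positions < |v|.
OracleMachine : Set
OracleMachine = List ℕ → Bool

HaltsOn : OracleMachine → Baire → Set
HaltsOn M f = ∃ λ n → M (f ↾ n) ≡ true

SemiDecidesIn𝒞 : OracleMachine → Numbering → (ℕ → ℕ) → Set
SemiDecidesIn𝒞 M C h =
  ∀ i → (HaltsOn M (C i) → InA C h (C i)) × (InA C h (C i) → HaltsOn M (C i))

module Submission where

-- Suppose a cylinder [u] meets 𝒞 and [u] ∩ 𝒞 ⊆ A_{𝒞,h}, and let
-- L = |u|.  Only the finitely many functions f_0, …, f_k with k = h(L+1) can
-- witness K_𝒞(v) ≤ h(L+1) for a sequence v of length L+1, so some value x is
-- different from every f_i(L) with i ≤ k.  By density some f_j extends u x;
-- it lies in [u] ∩ 𝒞 ⊆ A, hence some f_i with i ≤ k extends u x as well,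
-- forcing f_i(L) = x: a contradiction.
-- For the second, f_0 ∈ A (it is its own witness of index 0).  If M semi-decides
-- A ∩ 𝒞, then M^{f_0} halts after reading a finite prefix u of f_0, and so M
-- halts on every f ∈ [u] ∩ 𝒞; that cylinder is then an interior point of A in 𝒞,
-- which the first claim excludes.

open import Defs
open import Data.Nat using (ℕ; zero; suc; _≤_; _⊔_; z≤n; s≤s)
open import Data.Nat.Properties
  using (≤-refl; ≤-trans; m≤m⊔n; m≤n⊔m; m≤n⇒m<n∨m≡n; m<1+n⇒m≤n; <⇒≢; +-comm)
open import Data.Product using (∃; _×_; _,_; proj₁; proj₂)
open import Data.Sum using (inj₁; inj₂)
open import Data.List using (List; _∷ʳ_; map; upTo; applyUpTo; length)
open import Data.List.Properties using (length-map; length-upTo; length-++; map-upTo; applyUpTo-∷ʳ; ∷ʳ-injective)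
open import Relation.Nullary using (¬_)
open import Relation.Binary.PropositionalEquality
  using (_≡_; _≢_; refl; sym; trans; cong; subst; module ≡-Reasoning)

length-↾ : (f : Baire) (n : ℕ) → length (f ↾ n) ≡ n
length-↾ f n = trans (length-map f (upTo n)) (length-upTo n)

extends-↾ : (f : Baire) (n : ℕ) → Extends f (f ↾ n)
extends-↾ f n = cong (f ↾_) (length-↾ f n)

extends-↾⇒↾≡ : (f g : Baire) (n : ℕ) → Extends g (f ↾ n) → g ↾ n ≡ f ↾ n
extends-↾⇒↾≡ f g n = subst (λ m → g ↾ m ≡ f ↾ n) (length-↾ f n)

length-∷ʳ : (u : List ℕ) (x : ℕ) → length (u ∷ʳ x) ≡ suc (length u)
length-∷ʳ u x = trans (length-++ u) (+-comm (length u) 1)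

↾-suc : (f : Baire) (n : ℕ) → f ↾ suc n ≡ (f ↾ n) ∷ʳ f n
↾-suc f n = begin
  map f (upTo (suc n))        ≡⟨ map-upTo f (suc n) ⟩
  applyUpTo f (suc n)         ≡⟨ sym (applyUpTo-∷ʳ f n) ⟩
  applyUpTo f n ∷ʳ f n        ≡⟨ cong (_∷ʳ f n) (sym (map-upTo f n)) ⟩
  map f (upTo n) ∷ʳ f n       ∎
  where open ≡-Reasoning

extends-∷ʳ : (f : Baire) (u : List ℕ) (x : ℕ) →
  Extends f (u ∷ʳ x) → Extends f u × f (length u) ≡ x
extends-∷ʳ f u x ext = ∷ʳ-injective (f ↾ length u) u prefix
  where
    prefix : (f ↾ length u) ∷ʳ f (length u) ≡ u ∷ʳ x
    prefix = trans (sym (↾-suc f (length u)))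
                   (subst (λ m → f ↾ m ≡ u ∷ʳ x) (length-∷ʳ u x) ext)

maxUpTo : (ℕ → ℕ) → ℕ → ℕ
maxUpTo g zero    = g zero
maxUpTo g (suc k) = maxUpTo g k ⊔ g (suc k)

≤-maxUpTo : (g : ℕ → ℕ) {i : ℕ} (k : ℕ) → i ≤ k → g i ≤ maxUpTo g k
≤-maxUpTo g zero    z≤n = ≤-refl
≤-maxUpTo g (suc k) i≤1+k with m≤n⇒m<n∨m≡n i≤1+k
... | inj₁ i<1+k = ≤-trans (≤-maxUpTo g k (m<1+n⇒m≤n i<1+k)) (m≤m⊔n _ _)
... | inj₂ refl  = m≤n⊔m _ _

avoid : (g : ℕ → ℕ) (k : ℕ) → ℕ
avoid g k = suc (maxUpTo g k)

avoid-fresh : (g : ℕ → ℕ) {i : ℕ} (k : ℕ) → i ≤ k → g i ≢ avoid g k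
avoid-fresh g k i≤k = <⇒≢ (s≤s (≤-maxUpTo g k i≤k))

InA-prefix : (C : Numbering) (h : ℕ → ℕ) (f : Baire) (v : List ℕ) →
  InA C h f → Extends f v → K≤ C v (h (length v))
InA-prefix C h f v f∈A f⊒v = subst (λ w → K≤ C w (h (length v))) f⊒v (f∈A (length v))

first∈A : (C : Numbering) (h : ℕ → ℕ) → InA C h (C 0)
first∈A C h n = 0 , z≤n , extends-↾ (C 0) n

halting-open : (M : OracleMachine) (f : Baire) → HaltsOn M f →
  ∃ λ u → Extends f u × (∀ g → Extends g u → HaltsOn M g)
halting-open M f (n , halts) = f ↾ n , extends-↾ f n , λ g g⊒u →
  n , trans (cong M (extends-↾⇒↾≡ f g n g⊒u)) halts

InA-∷ʳ : (C : Numbering) (h : ℕ → ℕ) (f : Baire) (u : List ℕ) (x : ℕ) →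
  InA C h f → Extends f (u ∷ʳ x) → ∃ λ i → i ≤ h (suc (length u)) × C i (length u) ≡ x
InA-∷ʳ C h f u x f∈A f⊒ux =
  let (i , i≤h , i⊒ux) = InA-prefix C h f (u ∷ʳ x) f∈A f⊒ux
  in  i , subst (λ m → i ≤ h m) (length-∷ʳ u x) i≤h , proj₂ (extends-∷ʳ (C i) u x i⊒ux)

-- A_{𝒞,h} has empty interior in 𝒞 whenever 𝒞 is dense: a member of 𝒞 in
-- [u x], with x avoided by f_0(|u|), …, f_k(|u|), k = h(|u|+1), escapes A.
emptyInterior : (C : Numbering) → Dense C → (h : ℕ → ℕ) → ¬ NonemptyInteriorIn𝒞 C h
emptyInterior C dense h (u , _ , interior) = refute (dense (u ∷ʳ x))
  where
    valueAt|u| : ℕ → ℕ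
    valueAt|u| i = C i (length u)
    k : ℕ
    k = h (suc (length u))
    x : ℕ
    x = avoid valueAt|u| k
    refute : ¬ (∃ λ j → Extends (C j) (u ∷ʳ x))
    refute (j , j⊒ux) =
      let j∈A              = interior j (proj₁ (extends-∷ʳ (C j) u x j⊒ux))
          (i , i≤k , fi≡x) = InA-∷ʳ C h (C j) u x j∈A j⊒ux
      in  avoid-fresh valueAt|u| k i≤k fi≡x

-- No oracle machine semi-decides A_{𝒞,h} ∩ 𝒞: the cylinder on which it halts
-- around f_0 ∈ A would be an interior point of A in 𝒞.
notSemiDecidable : (C : Numbering) → Dense C → (h : ℕ → ℕ) →
  ¬ (∃ λ (M : OracleMachine) → SemiDecidesIn𝒞 M C h)
notSemiDecidable C dense h (M , decides) =
  let (u , first⊒u , haltsNear) = halting-open M (C 0) (proj₂ (decides 0) (first∈A C h))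
  in  emptyInterior C dense h
        (u , (0 , first⊒u) , λ i i⊒u → proj₁ (decides i) (haltsNear (C i) i⊒u))

-- Both claims hold for every h.
mainTheorem3 : (C : Numbering) → Dense C → (h : ℕ → ℕ) → IsOrder h →
    ¬ NonemptyInteriorIn𝒞 C h × ¬ (∃ λ (M : OracleMachine) → SemiDecidesIn𝒞 M C h)
mainTheorem3 C dense h _ = emptyInterior C dense h , notSemiDecidable C dense h
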